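{- Assume $\alpha\neq\beta$ and let $\rho$, $\widehat\Upsilon_n$, $H_n$, $\widehat M_n$, $H_{a,n_1,\dots,n_l}$, $\widehat\Upsilon_{a,n_1,\dots,n_l}$ be as in the context. Then for every $n\ge1$, $$\widehat M_1\cdots\widehat M_n=\begin{pmatrix}1&0\\0&1\end{pmatrix}+\sum_{a=1}^nH_a\widehat\Upsilon_a+\sum H_{a,n_1,\dots,n_l}\widehat\Upsilon_{a,n_1,\dots,n_l},$$ where the last sum runs over all $a\ge1$, $l\ge1$ and $n_1,\dots,n_l\ge1$ with $l+a+\sum_{i=1}^ln_i\le n$.
   Context: Let $p$ be a prime, $a_p$ and $\epsilon(p)$ elements of $\mathbb C_p$ with $\epsilon(p)$ a root of unity, and $\alpha,\beta$ the roots of $X^2-a_pX+\epsilon(p)p$. For $i\ge1$ let $\widehat\Phi_{p^i}(1+T)=\Phi_{p^i}(1+T)/(1+T)^{\frac12p^{i-1}(p-1)}$ ($\Phi_{p^i}$ the $p^i$-th cyclotomic polynomial), except $\widehat\Phi_2(1+T)=\Phi_2(1+T)$ for $p=2$. Put $\rho=\alpha/\beta$, $\widehat\Upsilon_n=\frac1{\beta-\alpha}\big(\beta-\frac{\widehat\Phi_{p^n}(1+T)}{\alpha}\big)$, $H_n=\begin{pmatrix}-1&-\rho^{n+1}\\\rho^{ -n}&\rho\end{pmatrix}$, $\widehat M_n=\begin{pmatrix}1&0\\0&1\end{pmatrix}+H_n\widehat\Upsilon_n$, $H_{a,n_1,\dots,n_l}=H_aH_{a+n_1+1}H_{a+n_1+n_2+2}\cdots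 H_{a+n_1+\cdots+n_l+l}$ and $\widehat\Upsilon_{a,n_1,\dots,n_l}=\widehat\Upsilon_a\widehat\Upsilon_{a+n_1+1}\widehat\Upsilon_{a+n_1+n_2+2}\cdots\widehat\Upsilon_{a+n_1+\cdots+n_l+l}$. -}

module Defs where

open import Algebra.Bundles using (CommutativeRing)
open import Data.Nat as ℕ using (ℕ; zero; suc; _∸_; _≤?_)
open import Data.Nat.DivMod using (_/_)
open import Data.List using (List; []; _∷_; map; concatMap; upTo; foldr; filter)
open import Data.Nat.ListAction using (sum)

range : ℕ → List ℕ
range n = map suc (upTo n)

tuples : ℕ → ℕ → List (List ℕ)
tuples zero    m = [] ∷ []
tuples (suc l) m = concatMap (λ k → map (k ∷_) (tuples l m)) (range m)

-- the index list  a , a+n₁+1 , a+n₁+n₂+2 , … , a+n₁+⋯+n_l+l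
positions : ℕ → List ℕ → List ℕ
positions a []       = a ∷ []
positions a (k ∷ ks) = a ∷ positions (a ℕ.+ k ℕ.+ 1) ks

-- exponent ½ p^{i-1}(p-1) of (1+T) in Φ̂_{p^i}; floor division is exact except
-- for p = 2, i = 1, where it gives 0, i.e. Φ̂₂(1+T) = Φ₂(1+T) as in the paper
hatExp : ℕ → ℕ → ℕ
hatExp p i = (p ℕ.^ (i ∸ 1) ℕ.* (p ∸ 1)) / 2

module Setup {c ℓ} (R : CommutativeRing c ℓ) where
  open CommutativeRing R

  infixr 8 _^_
  _^_ : Carrier → ℕ → Carrier
  x ^ zero  = 1#
  x ^ suc n = x * (x ^ n)

  natR : ℕ → Carrier
  natR zero    = 0#
  natR (suc n) = 1# + natR n

  sumR : List Carrier → Carrier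
  sumR = foldr _+_ 0#

  prodR : List Carrier → Carrier
  prodR = foldr _*_ 1#

  record M2 : Set c where
    constructor mat
    field
      e11 e12 e21 e22 : Carrier
  open M2 public

  _≈M_ : M2 → M2 → Set ℓ
  A ≈M B = (e11 A ≈ e11 B) × (e12 A ≈ e12 B) × (e21 A ≈ e21 B) × (e22 A ≈ e22 B)
    where open import Data.Product using (_×_)

  I2 : M2
  I2 = mat 1# 0# 0# 1#

  O2 : M2
  O2 = mat 0# 0# 0# 0#

  infixl 6 _⊕_
  _⊕_ : M2 → M2 → M2
  A ⊕ B = mat (e11 A + e11 B) (e12 A + e12 B) (e21 A + e21 B) (e22 A + e22 B)

  infixl 7 _⊗_
  _⊗_ : M2 → M2 → M2
  A ⊗ B = mat (e11 A * e11 B + e12 A * e21 B) (e11 A * e12 B + e12 A * e22 B)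
              (e21 A * e11 B + e22 A * e21 B) (e21 A * e12 B + e22 A * e22 B)

  infixl 7 _·_
  _·_ : Carrier → M2 → M2
  s · A = mat (s * e11 A) (s * e12 A) (s * e21 A) (s * e22 A)

  sumM : List M2 → M2
  sumM = foldr _⊕_ O2

  prodM : List M2 → M2
  prodM = foldr _⊗_ I2

  Φ : ℕ → ℕ → Carrier → Carrier
  Φ p i X = sumR (map (λ j → X ^ (j ℕ.* p ℕ.^ (i ∸ 1))) (upTo p))

  -- The quantities of the paper. α⁻¹, β⁻¹ are inverses of α, β; δ is the
  -- inverse of β - α; T is the variable; u is the inverse of 1 + T.
  module Quantities (p : ℕ) (α β α⁻¹ β⁻¹ δ T u : Carrier) where

    ρ : Carrier
    ρ = α * β⁻¹

    ρ⁻¹ : Carrier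
    ρ⁻¹ = β * α⁻¹

    Φhat : ℕ → Carrier
    Φhat i = Φ p i (1# + T) * u ^ hatExp p i

    Υ : ℕ → Carrier
    Υ n = δ * (β - Φhat n * α⁻¹)

    H : ℕ → M2
    H n = mat (- 1#) (- (ρ ^ suc n)) (ρ⁻¹ ^ n) ρ

    Mhat : ℕ → M2
    Mhat n = I2 ⊕ Υ n · H n

    Hs : ℕ → List ℕ → M2
    Hs a ns = prodM (map H (positions a ns))

    Υs : ℕ → List ℕ → Carrier
    Υs a ns = prodR (map Υ (positions a ns))

    -- Σ over a ≥ 1, l ≥ 1, n₁,…,n_l ≥ 1 with l + a + Σ nᵢ ≤ n
    -- (a ≤ n, l ≤ n, nᵢ ≤ n are implied by the constraint)
    bigSum : ℕ → M2
    bigSum n = sumM (concatMap (λ a → concatMap (λ l →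
                 map (λ ns → Υs a ns · Hs a ns)
                     (filter (λ ns → (l ℕ.+ a ℕ.+ sum ns) ≤? n) (tuples l n)))
                 (range n)) (range n))

-- Since H_a H_{a+1} = 0 (H_n is the outer product of (-1, ρ^{-n}) and (1, ρ^{n+1}), and
-- (1, ρ^{n+1}) is orthogonal to (-1, ρ^{-n-1})), the matrices E_a = Υ̂_a H_a satisfy
-- E_a E_{a+1} = 0.  Expanding ∏_{a=1}^n (1 + E_a) gives the sum of E_{p₀} ⋯ E_{p_l} over
-- all words p₀ < ⋯ < p_l in [1, n]; the words with two consecutive letters vanish, and
-- the others are exactly a, a+n₁+1, …, a+n₁+⋯+n_l+l with nᵢ ≥ 1.  This holds in any
-- semiring: by descending induction on a, ∏_{b ≥ a} (1 + e_b) = 1 + Σ_{b ≥ a} W_b, where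
-- W_b, the sum over the admissible words starting at b, satisfies
-- W_b = e_b (1 + Σ_{c ≥ b+2} W_c) and e_b W_{b+1} = 0.

{-# OPTIONS --safe #-}
module Submission where

open import Defs
open import Algebra.Bundles using (CommutativeRing; Semiring)
open import Data.Bool using (Bool; true; false; if_then_else_)
open import Data.Nat as ℕ using (ℕ; zero; suc; _<_; _≤_; _≤?_; z≤n; s≤s)
import Data.Nat.Properties as ℕ
open import Data.Nat.ListAction renaming (sum to sumℕ)
open import Data.Nat.Primality using (Prime)
open import Data.List using (List; []; _∷_; _++_; map; concatMap; filter; applyUpTo; upTo; foldr)
open import Data.List.Properties using (map-∘; map-upTo; map-concatMap)
open import Data.Product using (Σ; _×_; _,_)
open import Function using (_∘_)
open import Relation.Nullary using (¬_; does; yes; no)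
open import Relation.Nullary.Decidable using (dec-true; dec-false)
open import Relation.Unary using (Pred; Decidable)
open import Relation.Binary.PropositionalEquality as ≡ using (_≡_)
open import Relation.Binary.Structures using (IsEquivalence)

applyUpTo-cong : ∀ {a} {A : Set a} {f g : ℕ → A} k → (∀ j → f j ≡ g j) →
                 applyUpTo f k ≡ applyUpTo g k
applyUpTo-cong zero    f≡g = ≡.refl
applyUpTo-cong (suc k) f≡g = ≡.cong₂ _∷_ (f≡g 0) (applyUpTo-cong k (f≡g ∘ suc))

length-shift : ∀ l a k s → suc l ℕ.+ a ℕ.+ (k ℕ.+ s) ≡ l ℕ.+ (a ℕ.+ k ℕ.+ 1) ℕ.+ s
length-shift = solve-∀ where open import Data.Nat.Tactic.RingSolver

map-range : ∀ {a} {A : Set a} (f : ℕ → A) n → map f (range n) ≡ applyUpTo (f ∘ suc) n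
map-range f n = ≡.trans (≡.sym (map-∘ (upTo n))) (map-upTo (f ∘ suc) n)

module SemiringSums {c ℓ} (S : Semiring c ℓ) where
  open Semiring S
  open import Algebra.Properties.CommutativeSemigroup +-commutativeSemigroup
    using (interchange; x∙yz≈y∙xz; xy∙z≈x∙zy)
  open import Relation.Binary.Reasoning.Setoid setoid

  ∑ : List Carrier → Carrier
  ∑ = foldr _+_ 0#

  ∏ : List Carrier → Carrier
  ∏ = foldr _*_ 1#

  ∑-++ : ∀ xs ys → ∑ (xs ++ ys) ≈ ∑ xs + ∑ ys
  ∑-++ []       ys = sym (+-identityˡ _)
  ∑-++ (x ∷ xs) ys = trans (+-congˡ (∑-++ xs ys)) (sym (+-assoc _ _ _))

  module _ {a} {A : Set a} where

    ∑-concatMap : ∀ (F : A → List Carrier) xs → ∑ (concatMap F xs) ≈ ∑ (map (∑ ∘ F) xs)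
    ∑-concatMap F []       = refl
    ∑-concatMap F (x ∷ xs) = trans (∑-++ (F x) (concatMap F xs)) (+-congˡ (∑-concatMap F xs))

    ∑-concatMap-cong : ∀ (F G : A → List Carrier) xs → (∀ x → ∑ (F x) ≈ ∑ (G x)) →
                       ∑ (concatMap F xs) ≈ ∑ (concatMap G xs)
    ∑-concatMap-cong F G []       F≈G = refl
    ∑-concatMap-cong F G (x ∷ xs) F≈G = begin
      ∑ (F x ++ concatMap F xs)          ≈⟨ ∑-++ (F x) _ ⟩
      ∑ (F x) + ∑ (concatMap F xs)       ≈⟨ +-cong (F≈G x) (∑-concatMap-cong F G xs F≈G) ⟩
      ∑ (G x) + ∑ (concatMap G xs)       ≈⟨ ∑-++ (G x) _ ⟨
      ∑ (G x ++ concatMap G xs)          ∎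

    ∑-map-cong : ∀ {f g : A → Carrier} xs → (∀ x → f x ≈ g x) →
                 ∑ (map f xs) ≈ ∑ (map g xs)
    ∑-map-cong []       f≈g = refl
    ∑-map-cong (x ∷ xs) f≈g = +-cong (f≈g x) (∑-map-cong xs f≈g)

    ∑-map-zero : ∀ {f : A → Carrier} xs → (∀ x → f x ≈ 0#) → ∑ (map f xs) ≈ 0#
    ∑-map-zero []       f≈0 = refl
    ∑-map-zero (x ∷ xs) f≈0 = trans (+-cong (f≈0 x) (∑-map-zero xs f≈0)) (+-identityˡ 0#)

    *-distribˡ-∑-map : ∀ x (f : A → Carrier) xs →
                       x * ∑ (map f xs) ≈ ∑ (map (λ y → x * f y) xs)
    *-distribˡ-∑-map x f []       = zeroʳ x
    *-distribˡ-∑-map x f (y ∷ ys) = trans (distribˡ x _ _) (+-congˡ (*-distribˡ-∑-map x f ys))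

  guard : Bool → Carrier → Carrier
  guard b x = if b then x else 0#

  *-guard : ∀ x b y → x * guard b y ≈ guard b (x * y)
  *-guard x true  y = refl
  *-guard x false y = zeroʳ x

  ∑-filter : ∀ {a p} {A : Set a} {P : Pred A p} (P? : Decidable P) (f : A → Carrier) xs →
             ∑ (map f (filter P? xs)) ≈ ∑ (map (λ x → guard (does (P? x)) (f x)) xs)
  ∑-filter P? f []       = refl
  ∑-filter P? f (x ∷ xs) with does (P? x)
  ... | true  = +-congˡ (∑-filter P? f xs)
  ... | false = trans (∑-filter P? f xs) (sym (+-identityˡ _))

  ∑< : ℕ → (ℕ → Carrier) → Carrier
  ∑< N f = ∑ (applyUpTo f N)

  ∑-map-range : ∀ (f : ℕ → Carrier) n → ∑ (map f (range n)) ≡ ∑< n (f ∘ suc)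
  ∑-map-range f n = ≡.cong ∑ (map-range f n)

  ∑<-cong : ∀ N {f g} → (∀ j → j < N → f j ≈ g j) → ∑< N f ≈ ∑< N g
  ∑<-cong zero    f≈g = refl
  ∑<-cong (suc N) f≈g =
    +-cong (f≈g 0 (s≤s z≤n)) (∑<-cong N λ j j<N → f≈g (suc j) (s≤s j<N))

  ∑<-zero : ∀ N {f} → (∀ j → f j ≈ 0#) → ∑< N f ≈ 0#
  ∑<-zero zero    f≈0 = refl
  ∑<-zero (suc N) f≈0 = trans (+-cong (f≈0 0) (∑<-zero N (f≈0 ∘ suc))) (+-identityˡ 0#)

  ∑<-extend : ∀ N f → f N ≈ 0# → ∑< (suc N) f ≈ ∑< N f
  ∑<-extend zero    f fN≈0 = trans (+-identityʳ _) fN≈0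
  ∑<-extend (suc N) f fN≈0 = +-congˡ (∑<-extend N (f ∘ suc) fN≈0)

  ∑<-+ : ∀ N (f g : ℕ → Carrier) → ∑< N (λ j → f j + g j) ≈ ∑< N f + ∑< N g
  ∑<-+ zero    f g = sym (+-identityˡ 0#)
  ∑<-+ (suc N) f g = trans (+-congˡ (∑<-+ N (f ∘ suc) (g ∘ suc))) (interchange _ _ _ _)

  *-distribˡ-∑< : ∀ N x f → x * ∑< N f ≈ ∑< N (λ j → x * f j)
  *-distribˡ-∑< zero    x f = zeroʳ x
  *-distribˡ-∑< (suc N) x f = trans (distribˡ x _ _) (+-congˡ (*-distribˡ-∑< N x (f ∘ suc)))

  ∑<-swap : ∀ N M (f : ℕ → ℕ → Carrier) →
            ∑< N (λ i → ∑< M (f i)) ≈ ∑< M (λ j → ∑< N (λ i → f i j))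
  ∑<-swap zero    M f = sym (∑<-zero M (λ _ → refl))
  ∑<-swap (suc N) M f = trans (+-congˡ (∑<-swap N M (f ∘ suc)))
                              (sym (∑<-+ M (f 0) (λ j → ∑< N (λ i → f (suc i) j))))

  gapSum : (ℕ → List ℕ → Carrier) → ℕ → Carrier
  gapSum w n = ∑ (concatMap (λ a → concatMap (λ l →
                 map (w a) (filter (λ ns → (l ℕ.+ a ℕ.+ sumℕ ns) ≤? n) (tuples l n)))
                 (range n)) (range n))

  gapSum-cong : ∀ {w w′} n → (∀ a ns → w a ns ≈ w′ a ns) → gapSum w n ≈ gapSum w′ n
  gapSum-cong n w≈w′ =
    ∑-concatMap-cong _ _ (range n) λ a → ∑-concatMap-cong _ _ (range n) λ l →
      ∑-map-cong (filter (λ ns → (l ℕ.+ a ℕ.+ sumℕ ns) ≤? n) (tuples l n)) (w≈w′ a)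

  module GapExpansion (e : ℕ → Carrier) (e-nilpotent : ∀ a → e a * e (suc a) ≈ 0#) where

    wordProduct : ℕ → List ℕ → Carrier
    wordProduct a ns = ∏ (map e (positions a ns))

    module _ (n : ℕ) where

      -- weight a l sums wordProduct a over the words a = p₀ < p₁ < ⋯ < p_l ≤ n whose
      -- gaps are all ≥ 2; weightFrom a sums over all lengths l.
      weight : ℕ → ℕ → Carrier
      weight a l = ∑ (map (λ ns → guard (does ((l ℕ.+ a ℕ.+ sumℕ ns) ≤? n)) (wordProduct a ns))
                          (tuples l n))

      weightFrom : ℕ → Carrier
      weightFrom a = ∑< (suc n) (weight a)

      weight-0 : ∀ {a} → a ≤ n → weight a 0 ≈ e a
      weight-0 {a} a≤n
        rewrite dec-true ((a ℕ.+ 0) ≤? n) (≡.subst (_≤ n) (≡.sym (ℕ.+-identityʳ a)) a≤n)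
        = trans (+-identityʳ _) (*-identityʳ _)

      weight-vanishes : ∀ {a} l → n < l ℕ.+ a → weight a l ≈ 0#
      weight-vanishes {a} l n<l+a = ∑-map-zero (tuples l n) λ ns →
        reflexive (≡.cong (λ b → guard b (wordProduct a ns))
          (dec-false ((l ℕ.+ a ℕ.+ sumℕ ns) ≤? n) λ l+a+s≤n →
            ℕ.<⇒≱ n<l+a (ℕ.≤-trans (ℕ.m≤m+n (l ℕ.+ a) (sumℕ ns)) l+a+s≤n)))

      weightFrom-vanishes : ∀ {a} → n < a → weightFrom a ≈ 0#
      weightFrom-vanishes {a} n<a =
        ∑<-zero (suc n) λ l → weight-vanishes l (ℕ.<-≤-trans n<a (ℕ.m≤n+m a l))

      weight-suc : ∀ a l → weight a (suc l) ≈ e a * ∑< n (λ j → weight (a ℕ.+ suc j ℕ.+ 1) l)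
      weight-suc a l = begin
        ∑ (map g (concatMap (λ k → map (k ∷_) (tuples l n)) (range n)))
          ≡⟨ ≡.cong ∑ (map-concatMap g _ (range n)) ⟩
        ∑ (concatMap (λ k → map g (map (k ∷_) (tuples l n))) (range n))
          ≈⟨ ∑-concatMap _ (range n) ⟩
        ∑ (map (λ k → ∑ (map g (map (k ∷_) (tuples l n)))) (range n))
          ≡⟨ ∑-map-range _ n ⟩
        ∑< n (λ j → ∑ (map g (map (suc j ∷_) (tuples l n))))
          ≈⟨ ∑<-cong n (λ j _ → prepend (suc j)) ⟩
        ∑< n (λ j → e a * weight (a ℕ.+ suc j ℕ.+ 1) l)
          ≈⟨ *-distribˡ-∑< n (e a) _ ⟨
        e a * ∑< n (λ j → weight (a ℕ.+ suc j ℕ.+ 1) l) ∎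
        where
        g : List ℕ → Carrier
        g ns = guard (does ((suc l ℕ.+ a ℕ.+ sumℕ ns) ≤? n)) (wordProduct a ns)

        prepend : ∀ k → ∑ (map g (map (k ∷_) (tuples l n))) ≈ e a * weight (a ℕ.+ k ℕ.+ 1) l
        prepend k = begin
          ∑ (map g (map (k ∷_) (tuples l n)))   ≡⟨ ≡.cong ∑ (map-∘ (tuples l n)) ⟨
          ∑ (map (g ∘ (k ∷_)) (tuples l n))     ≈⟨ ∑-map-cong (tuples l n) (λ ns →
            trans (reflexive (≡.cong (λ m → guard (does (m ≤? n)) (e a * w ns))
                                     (length-shift l a k (sumℕ ns))))
                  (sym (*-guard (e a) _ (w ns)))) ⟩
          ∑ (map (λ ns → e a * _) (tuples l n)) ≈⟨ *-distribˡ-∑-map (e a) _ (tuples l n) ⟨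
          e a * weight (a ℕ.+ k ℕ.+ 1) l        ∎
          where
          w = wordProduct (a ℕ.+ k ℕ.+ 1)

      weightFrom-unfold : ∀ {a} → a ≤ n →
                          weightFrom a ≈ e a * (1# + ∑< n (λ j → weightFrom (suc (suc a) ℕ.+ j)))
      weightFrom-unfold {a} a≤n = begin
        weight a 0 + ∑< n (λ l → weight a (suc l))
          ≈⟨ +-cong (weight-0 a≤n) (∑<-cong n λ l _ → weight-suc a l) ⟩
        e a + ∑< n (λ l → e a * ∑< n (λ j → weight (b j) l))
          ≈⟨ +-congˡ (*-distribˡ-∑< n (e a) _) ⟨
        e a + e a * ∑< n (λ l → ∑< n (λ j → weight (b j) l))
          ≈⟨ +-congˡ (*-congˡ (∑<-swap n n _)) ⟩
        e a + e a * ∑< n (λ j → ∑< n (weight (b j)))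
          ≈⟨ +-congˡ (*-congˡ (∑<-cong n λ j _ → sym (∑<-extend n (weight (b j))
                (weight-vanishes n (ℕ.m<m+n n (ℕ.m≤n+m 1 (a ℕ.+ suc j))))))) ⟩
        e a + e a * ∑< n (λ j → weightFrom (b j))
          ≈⟨ +-cong (*-identityʳ (e a))
                    (*-congˡ (∑<-cong n λ j _ → reflexive (≡.cong weightFrom (≡.sym (b≡ j))))) ⟨
        e a * 1# + e a * ∑< n (λ j → weightFrom (suc (suc a) ℕ.+ j))
          ≈⟨ distribˡ (e a) _ _ ⟨
        e a * (1# + ∑< n (λ j → weightFrom (suc (suc a) ℕ.+ j))) ∎
        where
        b : ℕ → ℕ
        b j = a ℕ.+ suc j ℕ.+ 1
        b≡ : ∀ j → b j ≡ suc (suc a) ℕ.+ j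
        b≡ j = ≡.trans (ℕ.+-comm (a ℕ.+ suc j) 1) (≡.cong suc (ℕ.+-suc a j))

      e*weightFrom-suc≈0 : ∀ a → e a * weightFrom (suc a) ≈ 0#
      e*weightFrom-suc≈0 a with suc a ℕ.≤? n
      ... | yes a<n = begin
        e a * weightFrom (suc a)          ≈⟨ *-congˡ (weightFrom-unfold a<n) ⟩
        e a * (e (suc a) * _)             ≈⟨ *-assoc _ _ _ ⟨
        (e a * e (suc a)) * _             ≈⟨ *-congʳ (e-nilpotent a) ⟩
        0# * _                            ≈⟨ zeroˡ _ ⟩
        0#                                ∎
      ... | no a≮n = trans (*-congˡ (weightFrom-vanishes (ℕ.≰⇒> a≮n))) (zeroʳ (e a))

      ∑weightFrom-split : ∀ {a} → 1 ≤ a →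
        ∑< n (λ j → weightFrom (a ℕ.+ j))
          ≈ weightFrom a + ∑< n (λ j → weightFrom (suc a ℕ.+ j))
      ∑weightFrom-split {a} 1≤a = begin
        ∑< n (λ j → weightFrom (a ℕ.+ j))
          ≈⟨ ∑<-extend n _ (weightFrom-vanishes (ℕ.m<n+m n 1≤a)) ⟨
        weightFrom (a ℕ.+ 0) + ∑< n (λ j → weightFrom (a ℕ.+ suc j))
          ≈⟨ +-cong (reflexive (≡.cong weightFrom (ℕ.+-identityʳ a)))
                    (∑<-cong n λ j _ → reflexive (≡.cong weightFrom (ℕ.+-suc a j))) ⟩
        weightFrom a + ∑< n (λ j → weightFrom (suc a ℕ.+ j)) ∎

      e*[1+∑weightFrom]≈weightFrom : ∀ {a} → a ≤ n →
        e a * (1# + ∑< n (λ j → weightFrom (suc a ℕ.+ j))) ≈ weightFrom a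
      e*[1+∑weightFrom]≈weightFrom {a} a≤n = begin
        e a * (1# + ∑< n (λ j → weightFrom (suc a ℕ.+ j)))
          ≈⟨ *-congˡ (+-congˡ (∑weightFrom-split (s≤s z≤n))) ⟩
        e a * (1# + (weightFrom (suc a) + G))
          ≈⟨ *-congˡ (x∙yz≈y∙xz _ _ _) ⟩
        e a * (weightFrom (suc a) + (1# + G))
          ≈⟨ distribˡ (e a) _ _ ⟩
        e a * weightFrom (suc a) + e a * (1# + G)
          ≈⟨ +-congʳ (e*weightFrom-suc≈0 a) ⟩
        0# + e a * (1# + G)
          ≈⟨ +-identityˡ _ ⟩
        e a * (1# + G)
          ≈⟨ weightFrom-unfold a≤n ⟨
        weightFrom a ∎
        where
        G = ∑< n (λ j → weightFrom (suc (suc a) ℕ.+ j))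

      expansion-from : ∀ k a → 1 ≤ a → a ℕ.+ k ≡ suc n →
        ∏ (applyUpTo (λ j → 1# + e (a ℕ.+ j)) k) ≈ 1# + ∑< n (λ j → weightFrom (a ℕ.+ j))
      expansion-from zero a _ a+0≡1+n =
        sym (trans (+-congˡ (∑<-zero n λ j →
                      weightFrom-vanishes (ℕ.<-≤-trans n<a (ℕ.m≤m+n a j))))
                   (+-identityʳ 1#))
        where
        n<a : n < a
        n<a = ≡.subst (n <_) (≡.trans (≡.sym a+0≡1+n) (ℕ.+-identityʳ a)) (ℕ.n<1+n n)
      expansion-from (suc k) a 1≤a a+1+k≡1+n = begin
        ∏ (applyUpTo (λ j → 1# + e (a ℕ.+ j)) (suc k))
          ≡⟨ ≡.cong₂ (λ x xs → (1# + e x) * ∏ xs) (ℕ.+-identityʳ a)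
               (applyUpTo-cong k λ j → ≡.cong (λ m → 1# + e m) (ℕ.+-suc a j)) ⟩
        (1# + e a) * ∏ (applyUpTo (λ j → 1# + e (suc a ℕ.+ j)) k)
          ≈⟨ *-congˡ (expansion-from k (suc a) (s≤s z≤n) 1+a+k≡1+n) ⟩
        (1# + e a) * (1# + F)
          ≈⟨ distribʳ _ _ _ ⟩
        1# * (1# + F) + e a * (1# + F)
          ≈⟨ +-cong (*-identityˡ _) (e*[1+∑weightFrom]≈weightFrom a≤n) ⟩
        (1# + F) + weightFrom a
          ≈⟨ xy∙z≈x∙zy _ _ _ ⟩
        1# + (weightFrom a + F)
          ≈⟨ +-congˡ (∑weightFrom-split 1≤a) ⟨
        1# + ∑< n (λ j → weightFrom (a ℕ.+ j)) ∎
        where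
        F = ∑< n (λ j → weightFrom (suc a ℕ.+ j))
        1+a+k≡1+n : suc a ℕ.+ k ≡ suc n
        1+a+k≡1+n = ≡.trans (≡.sym (ℕ.+-suc a k)) a+1+k≡1+n
        a≤n : a ≤ n
        a≤n = ≡.subst (a ≤_) (ℕ.suc-injective 1+a+k≡1+n) (ℕ.m≤m+n a k)

      gapSum≈∑weight : gapSum wordProduct n ≈ ∑< n (λ j → ∑< n (λ l → weight (suc j) (suc l)))
      gapSum≈∑weight = begin
        gapSum wordProduct n
          ≈⟨ ∑-concatMap _ (range n) ⟩
        ∑ (map (λ a → ∑ (concatMap (admissibleWords a) (range n))) (range n))
          ≈⟨ ∑-map-cong (range n) (λ a → trans (∑-concatMap _ (range n))
               (∑-map-cong (range n) λ l → ∑-filter _ (wordProduct a) (tuples l n))) ⟩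
        ∑ (map (λ a → ∑ (map (weight a) (range n))) (range n))
          ≡⟨ ∑-map-range _ n ⟩
        ∑< n (λ j → ∑ (map (weight (suc j)) (range n)))
          ≡⟨ ≡.cong ∑ (applyUpTo-cong n λ j → ∑-map-range (weight (suc j)) n) ⟩
        ∑< n (λ j → ∑< n (λ l → weight (suc j) (suc l))) ∎
        where
        admissibleWords : ℕ → ℕ → List Carrier
        admissibleWords a l =
          map (wordProduct a) (filter (λ ns → (l ℕ.+ a ℕ.+ sumℕ ns) ≤? n) (tuples l n))

      ∏[1+e]-expansion :
        ∏ (map (λ a → 1# + e a) (range n)) ≈ 1# + ∑ (map e (range n)) + gapSum wordProduct n
      ∏[1+e]-expansion = begin
        ∏ (map (λ a → 1# + e a) (range n))
          ≡⟨ ≡.cong ∏ (map-range _ n) ⟩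
        ∏ (applyUpTo (λ j → 1# + e (suc j)) n)
          ≈⟨ expansion-from n 1 (s≤s z≤n) ≡.refl ⟩
        1# + ∑< n (λ j → weightFrom (suc j))
          ≈⟨ +-congˡ (∑<-cong n λ j j<n → +-congʳ (weight-0 j<n)) ⟩
        1# + ∑< n (λ j → e (suc j) + ∑< n (λ l → weight (suc j) (suc l)))
          ≈⟨ +-congˡ (∑<-+ n _ _) ⟩
        1# + (∑< n (e ∘ suc) + ∑< n (λ j → ∑< n (λ l → weight (suc j) (suc l))))
          ≈⟨ +-assoc _ _ _ ⟨
        1# + ∑< n (e ∘ suc) + ∑< n (λ j → ∑< n (λ l → weight (suc j) (suc l)))
          ≈⟨ +-cong (+-congˡ (reflexive (∑-map-range e n))) gapSum≈∑weight ⟨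
        1# + ∑ (map e (range n)) + gapSum wordProduct n ∎

module Matrices {c ℓ} (R : CommutativeRing c ℓ) where
  open CommutativeRing R
  open Setup R
  open import Algebra.Solver.Ring.NaturalCoefficients.Default commutativeSemiring
  open import Algebra.Properties.Ring ring using (-1*x≈-x)
  open import Algebra.Properties.CommutativeSemigroup *-commutativeSemigroup
    using () renaming (interchange to *-interchange; x∙yz≈y∙zx to *-x∙yz≈y∙zx)

  ≈M-isEquivalence : IsEquivalence _≈M_
  ≈M-isEquivalence = record
    { refl  = refl , refl , refl , refl
    ; sym   = λ { (p , q , r , s) → sym p , sym q , sym r , sym s }
    ; trans = λ { (p , q , r , s) (p′ , q′ , r′ , s′) →
                  trans p p′ , trans q q′ , trans r r′ , trans s s′ }
    }

  ⊕-cong : ∀ {A B C D} → A ≈M B → C ≈M D → (A ⊕ C) ≈M (B ⊕ D)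
  ⊕-cong (p , q , r , s) (p′ , q′ , r′ , s′) =
    +-cong p p′ , +-cong q q′ , +-cong r r′ , +-cong s s′

  ⊗-cong : ∀ {A B C D} → A ≈M B → C ≈M D → (A ⊗ C) ≈M (B ⊗ D)
  ⊗-cong (p , q , r , s) (p′ , q′ , r′ , s′) =
    +-cong (*-cong p p′) (*-cong q r′) , +-cong (*-cong p q′) (*-cong q s′) ,
    +-cong (*-cong r p′) (*-cong s r′) , +-cong (*-cong r q′) (*-cong s s′)

  ·-cong : ∀ {s t A B} → s ≈ t → A ≈M B → (s · A) ≈M (t · B)
  ·-cong e (p , q , r , s) = *-cong e p , *-cong e q , *-cong e r , *-cong e s

  M2-semiring : Semiring c ℓ
  M2-semiring = record
    { Carrier = M2 ; _≈_ = _≈M_ ; _+_ = _⊕_ ; _*_ = _⊗_ ; 0# = O2 ; 1# = I2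
    ; isSemiring = record
      { isSemiringWithoutAnnihilatingZero = record
        { +-isCommutativeMonoid = record
          { isMonoid = record
            { isSemigroup = record
              { isMagma = record { isEquivalence = ≈M-isEquivalence ; ∙-cong = ⊕-cong }
              ; assoc = λ _ _ _ → +-assoc _ _ _ , +-assoc _ _ _ , +-assoc _ _ _ , +-assoc _ _ _
              }
            ; identity = (λ _ → +-identityˡ _ , +-identityˡ _ , +-identityˡ _ , +-identityˡ _)
                       , (λ _ → +-identityʳ _ , +-identityʳ _ , +-identityʳ _ , +-identityʳ _)
            }
          ; comm = λ _ _ → +-comm _ _ , +-comm _ _ , +-comm _ _ , +-comm _ _
          }
        ; *-cong = ⊗-cong
        ; *-assoc = λ _ _ _ → assoc _ _ _ _ _ _ _ _ , assoc _ _ _ _ _ _ _ _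
                            , assoc _ _ _ _ _ _ _ _ , assoc _ _ _ _ _ _ _ _
        ; *-identity = (λ _ → idˡ _ _ , idˡ _ _ , idʳ _ _ , idʳ _ _)
                     , (λ _ → idˡ′ _ _ , idʳ′ _ _ , idˡ′ _ _ , idʳ′ _ _)
        ; distrib = (λ _ _ _ → distˡ _ _ _ _ _ _ , distˡ _ _ _ _ _ _
                             , distˡ _ _ _ _ _ _ , distˡ _ _ _ _ _ _)
                  , (λ _ _ _ → distʳ _ _ _ _ _ _ , distʳ _ _ _ _ _ _
                             , distʳ _ _ _ _ _ _ , distʳ _ _ _ _ _ _)
        }
      ; zero = (λ _ → zeroˡ′ _ _ , zeroˡ′ _ _ , zeroˡ′ _ _ , zeroˡ′ _ _)
             , (λ _ → zeroʳ′ _ _ , zeroʳ′ _ _ , zeroʳ′ _ _ , zeroʳ′ _ _)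
      }
    }
    where
    assoc : ∀ x y p q r s u v →
            (x * p + y * r) * u + (x * q + y * s) * v ≈ x * (p * u + q * v) + y * (r * u + s * v)
    assoc = solve 8 (λ x y p q r s u v →
      (x :* p :+ y :* r) :* u :+ (x :* q :+ y :* s) :* v
        := x :* (p :* u :+ q :* v) :+ y :* (r :* u :+ s :* v)) refl
    idˡ : ∀ x y → 1# * x + 0# * y ≈ x
    idˡ = solve 2 (λ x y → con 1 :* x :+ con 0 :* y := x) refl
    idʳ : ∀ x y → 0# * x + 1# * y ≈ y
    idʳ = solve 2 (λ x y → con 0 :* x :+ con 1 :* y := y) refl
    idˡ′ : ∀ x y → x * 1# + y * 0# ≈ x
    idˡ′ = solve 2 (λ x y → x :* con 1 :+ y :* con 0 := x) refl
    idʳ′ : ∀ x y → x * 0# + y * 1# ≈ y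
    idʳ′ = solve 2 (λ x y → x :* con 0 :+ y :* con 1 := y) refl
    distˡ : ∀ x y p q r s → x * (p + r) + y * (q + s) ≈ (x * p + y * q) + (x * r + y * s)
    distˡ = solve 6 (λ x y p q r s →
      x :* (p :+ r) :+ y :* (q :+ s) := (x :* p :+ y :* q) :+ (x :* r :+ y :* s)) refl
    distʳ : ∀ x y p q r s → (x + p) * r + (y + q) * s ≈ (x * r + y * s) + (p * r + q * s)
    distʳ = solve 6 (λ x y p q r s →
      (x :+ p) :* r :+ (y :+ q) :* s := (x :* r :+ y :* s) :+ (p :* r :+ q :* s)) refl
    zeroˡ′ : ∀ x y → 0# * x + 0# * y ≈ 0#
    zeroˡ′ = solve 2 (λ x y → con 0 :* x :+ con 0 :* y := con 0) refl
    zeroʳ′ : ∀ x y → x * 0# + y * 0# ≈ 0#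
    zeroʳ′ = solve 2 (λ x y → x :* con 0 :+ y :* con 0 := con 0) refl

  module M₂ = Semiring M2-semiring

  ·-⊗-· : ∀ s t A B → ((s * t) · (A ⊗ B)) ≈M ((s · A) ⊗ (t · B))
  ·-⊗-· _ _ _ _ = law _ _ _ _ _ _ , law _ _ _ _ _ _ , law _ _ _ _ _ _ , law _ _ _ _ _ _
    where
    law : ∀ s t x y p q → (s * t) * (x * p + y * q) ≈ (s * x) * (t * p) + (s * y) * (t * q)
    law = solve 6 (λ s t x y p q →
      (s :* t) :* (x :* p :+ y :* q) := (s :* x) :* (t :* p) :+ (s :* y) :* (t :* q)) refl

  ·-identityˡ : ∀ A → (1# · A) ≈M A
  ·-identityˡ _ = *-identityˡ _ , *-identityˡ _ , *-identityˡ _ , *-identityˡ _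

  ·-zeroˡ : ∀ A → (0# · A) ≈M O2
  ·-zeroˡ _ = zeroˡ _ , zeroˡ _ , zeroˡ _ , zeroˡ _

  ·-zeroʳ : ∀ s → (s · O2) ≈M O2
  ·-zeroʳ _ = zeroʳ _ , zeroʳ _ , zeroʳ _ , zeroʳ _

  prodR-·-prodM : ∀ {a} {X : Set a} (s : X → Carrier) (A : X → M2) xs →
                  (prodR (map s xs) · prodM (map A xs)) ≈M prodM (map (λ x → s x · A x) xs)
  prodR-·-prodM s A []       = ·-identityˡ I2
  prodR-·-prodM s A (x ∷ xs) =
    M₂.trans (·-⊗-· (s x) _ (A x) _) (M₂.*-congˡ (prodR-·-prodM s A xs))

  outer : Carrier → Carrier → Carrier → Carrier → M2
  outer x y z w = mat (x * z) (x * w) (y * z) (y * w)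

  outer-⊗-outer : ∀ x y z w x′ y′ z′ w′ →
                  (outer x y z w ⊗ outer x′ y′ z′ w′)
                    ≈M ((z * x′ + w * y′) · outer x y z′ w′)
  outer-⊗-outer _ _ _ _ _ _ _ _ = law _ _ _ _ _ _ , law _ _ _ _ _ _ , law _ _ _ _ _ _ , law _ _ _ _ _ _
    where
    law : ∀ a b z w x′ y′ →
          (a * z) * (x′ * b) + (a * w) * (y′ * b) ≈ (z * x′ + w * y′) * (a * b)
    law = solve 6 (λ a b z w x′ y′ →
      (a :* z) :* (x′ :* b) :+ (a :* w) :* (y′ :* b) := (z :* x′ :+ w :* y′) :* (a :* b)) refl

  ^-inverse : ∀ {x y} → x * y ≈ 1# → ∀ n → x ^ n * y ^ n ≈ 1#
  ^-inverse x*y≈1 zero    = *-identityʳ 1#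
  ^-inverse {x} {y} x*y≈1 (suc n) = begin
    (x * x ^ n) * (y * y ^ n)   ≈⟨ *-interchange x (x ^ n) y (y ^ n) ⟩
    (x * y) * (x ^ n * y ^ n)   ≈⟨ *-cong x*y≈1 (^-inverse x*y≈1 n) ⟩
    1# * 1#                     ≈⟨ *-identityʳ 1# ⟩
    1#                          ∎
    where open import Relation.Binary.Reasoning.Setoid setoid

  module Nilpotency (p : ℕ) (α β α⁻¹ β⁻¹ δ T u : Carrier)
                    (α-inv : α * α⁻¹ ≈ 1#) (β-inv : β * β⁻¹ ≈ 1#) where
    open Quantities p α β α⁻¹ β⁻¹ δ T u

    ρ-inv : ρ * ρ⁻¹ ≈ 1#
    ρ-inv = begin
      (α * β⁻¹) * (β * α⁻¹)   ≈⟨ solve 4 (λ a b a′ b′ →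
                                   (a :* b′) :* (b :* a′) := (a :* a′) :* (b :* b′)) refl α β α⁻¹ β⁻¹ ⟩
      (α * α⁻¹) * (β * β⁻¹)   ≈⟨ *-cong α-inv β-inv ⟩
      1# * 1#                 ≈⟨ *-identityʳ 1# ⟩
      1#                      ∎
      where open import Relation.Binary.Reasoning.Setoid setoid

    H-outer : ∀ n → H n ≈M outer (- 1#) (ρ⁻¹ ^ n) 1# (ρ ^ suc n)
    H-outer n = sym (*-identityʳ _) , sym (-1*x≈-x _) , sym (*-identityʳ _) , sym ρ⁻ⁿρⁿ⁺¹≈ρ
      where
      ρ⁻ⁿρⁿ⁺¹≈ρ : ρ⁻¹ ^ n * (ρ * ρ ^ n) ≈ ρ
      ρ⁻ⁿρⁿ⁺¹≈ρ = begin
        ρ⁻¹ ^ n * (ρ * ρ ^ n)   ≈⟨ *-x∙yz≈y∙zx (ρ⁻¹ ^ n) ρ (ρ ^ n) ⟩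
        ρ * (ρ ^ n * ρ⁻¹ ^ n)   ≈⟨ *-congˡ (^-inverse ρ-inv n) ⟩
        ρ * 1#                  ≈⟨ *-identityʳ ρ ⟩
        ρ                       ∎
        where open import Relation.Binary.Reasoning.Setoid setoid

    H-nilpotent : ∀ n → (H n ⊗ H (suc n)) ≈M O2
    H-nilpotent n = begin
      H n ⊗ H (suc n)
        ≈⟨ M₂.*-cong (H-outer n) (H-outer (suc n)) ⟩
      outer (- 1#) (ρ⁻¹ ^ n) 1# (ρ ^ suc n) ⊗ outer (- 1#) (ρ⁻¹ ^ suc n) 1# (ρ ^ suc (suc n))
        ≈⟨ outer-⊗-outer _ _ _ _ _ _ _ _ ⟩
      (1# * - 1# + ρ ^ suc n * ρ⁻¹ ^ suc n) · outer (- 1#) (ρ⁻¹ ^ n) 1# (ρ ^ suc (suc n))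
        ≈⟨ ·-cong inner≈0 M₂.refl ⟩
      0# · outer (- 1#) (ρ⁻¹ ^ n) 1# (ρ ^ suc (suc n))
        ≈⟨ ·-zeroˡ _ ⟩
      O2 ∎
      where
      open import Relation.Binary.Reasoning.Setoid M₂.setoid
      inner≈0 : 1# * - 1# + ρ ^ suc n * ρ⁻¹ ^ suc n ≈ 0#
      inner≈0 = trans (+-cong (*-identityˡ _) (^-inverse ρ-inv (suc n))) (-‿inverseˡ 1#)

    ΥH-nilpotent : ∀ n → ((Υ n · H n) ⊗ (Υ (suc n) · H (suc n))) ≈M O2
    ΥH-nilpotent n =
      M₂.trans (M₂.sym (·-⊗-· _ _ _ _)) (M₂.trans (·-cong refl (H-nilpotent n)) (·-zeroʳ _))

lemma4p16 : ∀ {c ℓ} (R : CommutativeRing c ℓ) →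
    let open CommutativeRing R
        open Setup R
    in (p : ℕ) → Prime p →
       (α β ε α⁻¹ β⁻¹ δ T u : Carrier) →
       (Σ ℕ (λ m → (1 ≤ m) × (ε ^ m ≈ 1#))) →
       α * β ≈ ε * natR p →
       α * α⁻¹ ≈ 1# → β * β⁻¹ ≈ 1# →
       (β - α) * δ ≈ 1# → (1# + T) * u ≈ 1# →
       ¬ (α ≈ β) →
       let open Quantities p α β α⁻¹ β⁻¹ δ T u
       in (n : ℕ) → 1 ≤ n →
          prodM (map Mhat (range n))
            ≈M (I2 ⊕ sumM (map (λ a → Υ a · H a) (range n)) ⊕ bigSum n)
lemma4p16 R p _ α β _ α⁻¹ β⁻¹ δ T u _ _ α-inv β-inv _ _ _ n _ = begin
  prodM (map Mhat (range n))
    ≈⟨ ∏[1+e]-expansion n ⟩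
  I2 ⊕ sumM (map (λ a → Υ a · H a) (range n)) ⊕ gapSum wordProduct n
    ≈⟨ M₂.+-congˡ (gapSum-cong n λ a ns → prodR-·-prodM Υ H (positions a ns)) ⟨
  I2 ⊕ sumM (map (λ a → Υ a · H a) (range n)) ⊕ bigSum n ∎
  where
  open Setup R
  open Quantities p α β α⁻¹ β⁻¹ δ T u
  open Matrices R
  open Nilpotency p α β α⁻¹ β⁻¹ δ T u α-inv β-inv
  open SemiringSums M2-semiring
  open GapExpansion (λ a → Υ a · H a) ΥH-nilpotent
  open import Relation.Binary.Reasoning.Setoid M₂.setoid
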